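{- Let $a,b$ be positive integers and $\beta:[a]\times[b]\to\mathbb{Z}$, $\beta(i,j)=b+2i-1$. Then the poset $\Gamma([a]\times[b],R^\beta)$ is isomorphic to $\triangle_a\times[b]$.
   Context: $[a]\times[b]$ carries the componentwise order. For a finite poset $P$ and upper bound function $\beta:P\to\mathbb{Z}$, $R^\beta(p)$ is the set of $k$ such that some map $g:P\to\mathbb{Z}$ with $g(p_1)<g(p_2)$ whenever $p_1<_Pp_2$ and $1\le g(p')\le\beta(p')$ for all $p'$ has $g(p)=k$. For $R$ assigning a finite nonempty subset of $\mathbb{Z}$ to each $p\in P$, let $R(p)^*$ be $R(p)$ minus its largest element, $R(p)_{>k}$ the smallest element of $R(p)$ greater than $k$, and $R(p)_{<k}$ the largest element of $R(p)$ less than $k$. The gamma poset $\Gamma(P,R)$ has elements $(p,k)$ with $p\in P$, $k\in R(p)^*$, and is the partial order generated by the covering relations $(p_1,k_1)\lessdot(p_2,k_2)$ iff either (1) $p_1=p_2$ and $R(p_1)_{>k_2}=k_1$, or (2) $p_1\lessdot p_2$ in $P$, $k_1=R(p_1)_{<k_2}\neq\max R(p_1)$, and there is no $k>k_2$ in $R(p_2)$ with $k_1=R(p_1)_{<k}$. $\triangle_a$ is the subposet $\{(i,j):1\le i\le a,\ a-i+1\le j\le a\}$ of $[a]\times[a]$ with componentwise order; $\triangle_a\times[b]$ has the product order. -}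

module Defs where

open import Data.Nat as ℕ using (ℕ; _∸_)
open import Data.Integer as ℤ using (ℤ; +_)
open import Data.Product using (Σ; _×_; _,_)
open import Data.Sum using (_⊎_)
open import Relation.Nullary using (¬_)
open import Relation.Binary.PropositionalEquality using (_≡_)
open import Relation.Binary.Construct.Closure.ReflexiveTransitive using (Star)
open import Function.Bundles using (_⇔_)

-- A finite poset P is presented by a type D of "data", a predicate
-- InP : D → Set carving out the elements of P, and a strict order _<P_.

module GenericPoset {D : Set} (InP : D → Set) (_<P_ : D → D → Set) where

  Covers : D → D → Set
  Covers p q = p <P q × ¬ (Σ D λ r → InP r × p <P r × r <P q)

  Rβ : (β : D → ℤ) → D → ℤ → Set
  Rβ β p k =
    Σ (D → ℤ) λ g →
      (∀ p₁ p₂ → InP p₁ → InP p₂ → p₁ <P p₂ → g p₁ ℤ.< g p₂)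
      × (∀ p' → InP p' → (+ 1 ℤ.≤ g p') × (g p' ℤ.≤ β p'))
      × g p ≡ k

  module Gamma (R : D → ℤ → Set) where

    NotMax : D → ℤ → Set
    NotMax p k = Σ ℤ λ k' → R p k' × k ℤ.< k'

    InStar : D → ℤ → Set
    InStar p k = R p k × NotMax p k

    IsAbove : D → ℤ → ℤ → Set
    IsAbove p k k' = R p k' × k ℤ.< k' × (∀ k'' → R p k'' → k ℤ.< k'' → k' ℤ.≤ k'')

    IsBelow : D → ℤ → ℤ → Set
    IsBelow p k k' = R p k' × k' ℤ.< k × (∀ k'' → R p k'' → k'' ℤ.< k → k'' ℤ.≤ k')

    InΓ : D × ℤ → Set
    InΓ (p , k) = InP p × InStar p k

    ΓCov : D × ℤ → D × ℤ → Set
    ΓCov (p₁ , k₁) (p₂ , k₂) =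
      InΓ (p₁ , k₁) × InΓ (p₂ , k₂) ×
      ( (p₁ ≡ p₂ × IsAbove p₁ k₂ k₁)
      ⊎ (Covers p₁ p₂ × IsBelow p₁ k₂ k₁ × NotMax p₁ k₁
         × ¬ (Σ ℤ λ k → R p₂ k × k₂ ℤ.< k × IsBelow p₁ k k₁)))

    Γ≤ : D × ℤ → D × ℤ → Set
    Γ≤ = Star ΓCov

-- Order isomorphism between two posets presented as (data, membership, ≤).
-- Equality of elements is equality of the underlying data.

record OrderIso {D E : Set} (InD : D → Set) (_≤D_ : D → D → Set)
                (InE : E → Set) (_≤E_ : E → E → Set) : Set where
  field
    to      : (x : D) → InD x → E
    to-in   : (x : D) (px : InD x) → InE (to x px)
    from    : (y : E) → InE y → D
    from-in : (y : E) (py : InE y) → InD (from y py)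
    from-to : (x : D) (px : InD x) → from (to x px) (to-in x px) ≡ x
    to-from : (y : E) (py : InE y) → to (from y py) (from-in y py) ≡ y
    order   : (x y : D) (px : InD x) (py : InD y) →
              (x ≤D y) ⇔ (to x px ≤E to y py)

InGrid : ℕ → ℕ → ℕ × ℕ → Set
InGrid a b (i , j) = (1 ℕ.≤ i × i ℕ.≤ a) × (1 ℕ.≤ j × j ℕ.≤ b)

_<G_ : ℕ × ℕ → ℕ × ℕ → Set
(i₁ , j₁) <G (i₂ , j₂) = i₁ ℕ.≤ i₂ × j₁ ℕ.≤ j₂ × ¬ ((i₁ , j₁) ≡ (i₂ , j₂))

βGrid : ℕ → ℕ × ℕ → ℤ
βGrid b (i , j) = (+ (b ℕ.+ 2 ℕ.* i)) ℤ.- (+ 1)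

InTriB : ℕ → ℕ → (ℕ × ℕ) × ℕ → Set
InTriB a b ((i , j) , c) =
  (1 ℕ.≤ i × i ℕ.≤ a) × ((a ∸ i) ℕ.+ 1 ℕ.≤ j × j ℕ.≤ a) × (1 ℕ.≤ c × c ℕ.≤ b)

_≤TB_ : (ℕ × ℕ) × ℕ → (ℕ × ℕ) × ℕ → Set
((i₁ , j₁) , c₁) ≤TB ((i₂ , j₂) , c₂) = i₁ ℕ.≤ i₂ × j₁ ℕ.≤ j₂ × c₁ ℕ.≤ c₂

module GridGamma (a b : ℕ) where
  open GenericPoset (InGrid a b) _<G_ public
  open Gamma (Rβ (βGrid b)) public

InΓGrid : ℕ → ℕ → (ℕ × ℕ) × ℤ → Set
InΓGrid a b = GridGamma.InΓ a b

Γ≤Grid : ℕ → ℕ → (ℕ × ℕ) × ℤ → (ℕ × ℕ) × ℤ → Set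
Γ≤Grid a b = GridGamma.Γ≤ a b

{-# OPTIONS --safe #-}
module Submission where

open import Defs
open import Data.Nat
  using (ℕ; zero; suc; pred; _+_; _*_; _∸_; _⊓_; _≤_; _<_; _≤′_; ≤′-refl; ≤′-step; z≤n; s≤s; s≤s⁻¹)
open import Data.Nat.Properties
open import Data.Nat.Tactic.RingSolver using (solve-∀)
open import Data.Integer as ℤ using (ℤ; +_; ∣_∣)
import Data.Integer.Properties as ℤ
open import Data.Product using (Σ; _×_; _,_; proj₁; proj₂)
open import Data.Sum using (inj₁; inj₂)
open import Data.Empty using (⊥-elim)
open import Function using (_on_)
open import Function.Bundles using (mk⇔)
open import Relation.Nullary using (¬_; contradiction)
open import Relation.Binary.PropositionalEquality
open import Relation.Binary.Construct.Closure.ReflexiveTransitive using (ε; _◅_; _◅◅_; fold)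

-- A strictly increasing labelling g of [a]×[b] with 1 ≤ g ≤ β rises by at least
-- one per step, so the chains from (1,1) to (i,j) and from (i,j) to (i,b) give
-- i+j-1 ≤ g(i,j) ≤ 2i+j-1, and every value in between is attained: R^β(i,j) is
-- an interval of i+1 integers.
-- A point of Γ is thus a grid point (i,j) with an offset 0 ≤ t < i into it. Its
-- covering relations either lower t at a fixed grid point, or step to a grid
-- neighbour at the same offset, so (i,j,t) ↦ (a-t,i,j) is an order isomorphism.

stepwise-<⇒f[m]+d≤f[m+d] : (f : ℕ → ℕ) (m d : ℕ) →
  (∀ k → k < d → f (m + k) < f (m + suc k)) → f m + d ≤ f (m + d)
stepwise-<⇒f[m]+d≤f[m+d] f m zero _ =
  ≤-reflexive (trans (+-identityʳ (f m)) (cong f (sym (+-identityʳ m))))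
stepwise-<⇒f[m]+d≤f[m+d] f m (suc d) step = begin
  f m + suc d     ≡⟨ +-suc (f m) d ⟩
  suc (f m + d)   ≤⟨ s≤s (stepwise-<⇒f[m]+d≤f[m+d] f m d (λ k k<d → step k (m<n⇒m<1+n k<d))) ⟩
  suc (f (m + d)) ≤⟨ step d (n<1+n d) ⟩
  f (m + suc d)   ∎
  where open ≤-Reasoning

module GammaCovers {D : Set} (InP : D → Set) (_<P_ : D → D → Set) (R : D → ℤ → Set) where
  open GenericPoset InP _<P_
  open Gamma R

  ΓCov-same : ∀ {p n} → InΓ (p , + suc n) → InΓ (p , + n) → ΓCov (p , + suc n) (p , + n)
  ΓCov-same top@(_ , R[n+1] , _) bottom =
    top , bottom , inj₁ (refl , R[n+1] , ℤ.+<+ ≤-refl , λ _ _ → ℤ.i<j⇒suc[i]≤j)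

  IsBelow-≤-suc : ∀ {p k n} → R p (+ suc n) → IsBelow p k (+ n) → k ℤ.≤ + suc n
  IsBelow-≤-suc R[n+1] (_ , _ , maximal) =
    ℤ.≮⇒≥ (λ n+1<k → ℤ.<⇒≱ (ℤ.+<+ ≤-refl) (maximal _ R[n+1] n+1<k))

  ΓCov-cross : ∀ {p q n} → Covers p q → InΓ (p , + n) → R p (+ suc n) →
               InΓ (q , + suc n) → ΓCov (p , + n) (q , + suc n)
  ΓCov-cross p⋖q lower@(_ , (R[n] , _)) R[n+1] upper =
    lower , upper ,
    inj₂ (p⋖q , (R[n] , ℤ.+<+ ≤-refl , λ _ _ → ℤ.i<j⇒i≤pred[j]) , (_ , R[n+1] , ℤ.+<+ ≤-refl) ,
          λ (_ , _ , n+1<k , below) → ℤ.<⇒≱ n+1<k (IsBelow-≤-suc R[n+1] below))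

<G⇒sum< : ∀ {i₁ j₁ i₂ j₂} → (i₁ , j₁) <G (i₂ , j₂) → i₁ + j₁ < i₂ + j₂
<G⇒sum< (i≤ , j≤ , ≢) with m≤n⇒m<n∨m≡n i≤ | m≤n⇒m<n∨m≡n j≤
... | inj₁ i< | _          = +-mono-<-≤ i< j≤
... | inj₂ _  | inj₁ j<    = +-mono-≤-< i≤ j<
... | inj₂ refl | inj₂ refl = contradiction refl ≢

<G-right : ∀ {i j} → (i , j) <G (suc i , j)
<G-right {i} = n≤1+n i , ≤-refl , λ ()

<G-up : ∀ {i j} → (i , j) <G (i , suc j)
<G-up {j = j} = ≤-refl , n≤1+n j , λ ()

module Grid (a b : ℕ) where
  open GridGamma a b
  open GammaCovers (InGrid a b) _<G_ (Rβ (βGrid b))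

  β : ℕ × ℕ → ℤ
  β = βGrid b

  InGrid-between : ∀ {i j i′ j′ x y} → InGrid a b (i , j) → InGrid a b (i′ , j′) →
                   i ≤ x → x ≤ i′ → j ≤ y → y ≤ j′ → InGrid a b (x , y)
  InGrid-between ((1≤i , _) , (1≤j , _)) ((_ , i′≤a) , (_ , j′≤b)) i≤x x≤i′ j≤y y≤j′ =
    (≤-trans 1≤i i≤x , ≤-trans x≤i′ i′≤a) , (≤-trans 1≤j j≤y , ≤-trans y≤j′ j′≤b)

  sum≡suc⇒Covers : ∀ {i j i′ j′} → (i , j) <G (i′ , j′) → i′ + j′ ≡ suc (i + j) →
                   Covers (i , j) (i′ , j′)
  sum≡suc⇒Covers {i} {j} p<q eq =
    p<q , λ ((x , y) , _ , p<r , r<q) →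
      1+n≰n (subst (suc (suc (i + j)) ≤_) eq (≤-trans (s≤s (<G⇒sum< p<r)) (<G⇒sum< r<q)))

  module Labelling {g : ℕ × ℕ → ℤ}
      (mono : ∀ p q → InGrid a b p → InGrid a b q → p <G q → g p ℤ.< g q)
      (bounds : ∀ p → InGrid a b p → (+ 1 ℤ.≤ g p) × (g p ℤ.≤ β p)) where

    G : ℕ × ℕ → ℕ
    G p = ∣ g p ∣

    g≡+G : ∀ {p} → InGrid a b p → g p ≡ + G p
    g≡+G {p} gp = sym (ℤ.0≤i⇒+∣i∣≡i (ℤ.≤-trans (ℤ.+≤+ z≤n) (proj₁ (bounds p gp))))

    1≤G : ∀ {p} → InGrid a b p → 1 ≤ G p
    1≤G {p} gp = ℤ.drop‿+≤+ (subst (+ 1 ℤ.≤_) (g≡+G gp) (proj₁ (bounds p gp)))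

    G<β : ∀ {x y} → InGrid a b (x , y) → G (x , y) < b + 2 * x
    G<β {x} {y} gp =
      ℤ.drop‿+<+ (ℤ.i≤pred[j]⇒i<j (subst (ℤ._≤ β (x , y)) (g≡+G gp) (proj₂ (bounds (x , y) gp))))

    G-mono : ∀ {p q} → InGrid a b p → InGrid a b q → p <G q → G p < G q
    G-mono {p} {q} gp gq p<q = ℤ.drop‿+<+ (subst₂ ℤ._<_ (g≡+G gp) (g≡+G gq) (mono p q gp gq p<q))

    G-<-right : ∀ {x y} → 1 ≤ x → InGrid a b (suc x , y) → G (x , y) < G (suc x , y)
    G-<-right 1≤x g@((_ , 1+x≤a) , gy) = G-mono ((1≤x , <⇒≤ 1+x≤a) , gy) g <G-right

    G-<-up : ∀ {x y} → 1 ≤ y → InGrid a b (x , suc y) → G (x , y) < G (x , suc y)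
    G-<-up 1≤y g@(gx , (_ , 1+y≤b)) = G-mono (gx , (1≤y , <⇒≤ 1+y≤b)) g <G-up

    G-lower : ∀ {i j} → InGrid a b (suc i , j) → i + j ≤ G (suc i , j)
    G-lower {i} {suc j} ((_ , 1+i≤a) , (_ , 1+j≤b)) = begin
      i + suc j             ≡⟨ +-comm i (suc j) ⟩
      1 + j + i             ≤⟨ +-monoˡ-≤ i (+-monoˡ-≤ j (1≤G corner)) ⟩
      G (1 , 1) + j + i     ≤⟨ +-monoˡ-≤ i column ⟩
      G (1 , suc j) + i     ≤⟨ row ⟩
      G (suc i , suc j)     ∎
      where
        open ≤-Reasoning
        1≤a : 1 ≤ a
        1≤a = ≤-trans (s≤s z≤n) 1+i≤a
        corner : InGrid a b (1 , 1)
        corner = (≤-refl , 1≤a) , (≤-refl , ≤-trans (s≤s z≤n) 1+j≤b)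
        column : G (1 , 1) + j ≤ G (1 , 1 + j)
        column = stepwise-<⇒f[m]+d≤f[m+d] (λ y → G (1 , y)) 1 j
          (λ k k<j → G-<-up (s≤s z≤n) ((≤-refl , 1≤a) , (s≤s z≤n , ≤-trans (s≤s k<j) 1+j≤b)))
        row : G (1 , suc j) + i ≤ G (1 + i , suc j)
        row = stepwise-<⇒f[m]+d≤f[m+d] (λ x → G (x , suc j)) 1 i
          (λ k k<i → G-<-right (s≤s z≤n) ((s≤s z≤n , ≤-trans (s≤s k<i) 1+i≤a) , (s≤s z≤n , 1+j≤b)))

    G-upper : ∀ {i j} → InGrid a b (suc i , j) → G (suc i , j) ≤ i + j + suc i
    G-upper {i} {j} (gx , (1≤j , j≤b)) = s≤s⁻¹ (+-cancelˡ-≤ d _ _ (begin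
      d + suc (G (suc i , j))     ≡⟨ +-suc d _ ⟩
      suc (d + G (suc i , j))     ≡⟨ cong suc (+-comm d _) ⟩
      suc (G (suc i , j) + d)     ≤⟨ s≤s chain ⟩
      suc (G (suc i , j + d))     ≡⟨ cong (λ y → suc (G (suc i , y))) j+d≡b ⟩
      suc (G (suc i , b))         ≤⟨ G<β (gx , (≤-trans 1≤j j≤b , ≤-refl)) ⟩
      b + 2 * suc i               ≡⟨ cong (_+ 2 * suc i) (sym j+d≡b) ⟩
      j + d + 2 * suc i           ≡⟨ rearrange i j d ⟩
      d + suc (i + j + suc i)     ∎))
      where
        open ≤-Reasoning
        d = b ∸ j
        j+d≡b : j + d ≡ b
        j+d≡b = m+[n∸m]≡n j≤b
        chain : G (suc i , j) + d ≤ G (suc i , j + d)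
        chain = stepwise-<⇒f[m]+d≤f[m+d] (λ y → G (suc i , y)) j d
          (λ k k<d → subst (λ y → G (suc i , j + k) < G (suc i , y)) (sym (+-suc j k))
            (G-<-up (≤-trans 1≤j (m≤m+n j k))
              (gx , (s≤s z≤n , subst (_≤ b) (+-suc j k) (≤-trans (+-monoʳ-≤ j k<d) (≤-reflexive j+d≡b))))))
        rearrange : ∀ i j d → j + d + 2 * suc i ≡ d + suc (i + j + suc i)
        rearrange = solve-∀

  Rβ⇒offset : ∀ {i j k} → InGrid a b (suc i , j) → Rβ β (suc i , j) k →
              Σ ℕ λ t → t ≤ suc i × k ≡ + (i + j + t)
  Rβ⇒offset {i} {j} gr (g , mono , bounds , refl) =
    G (suc i , j) ∸ (i + j) ,
    m≤n+o⇒m∸n≤o _ (i + j) (G-upper gr) ,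
    trans (g≡+G gr) (cong +_ (sym (m+[n∸m]≡n (G-lower gr))))
    where open Labelling mono bounds

  offset⇒Rβ : ∀ {i j t} → InGrid a b (suc i , j) → t ≤ suc i → Rβ β (suc i , j) (+ (i + j + t))
  offset⇒Rβ {i} {j} {t} _ t≤1+i = g , mono , bounds , cong (λ s → + (i + j + s)) (m≤n⇒m⊓n≡m t≤1+i)
    where
      g : ℕ × ℕ → ℤ
      g (x , y) = + (pred x + y + t ⊓ x)
      mono : ∀ p q → InGrid a b p → InGrid a b q → p <G q → g p ℤ.< g q
      mono (suc x₁ , _) (suc x₂ , _) _ _ p<q =
        ℤ.+<+ (+-mono-<-≤ (s≤s⁻¹ (<G⇒sum< p<q)) (⊓-monoʳ-≤ t (proj₁ p<q)))
      bounds : ∀ p → InGrid a b p → (+ 1 ℤ.≤ g p) × (g p ℤ.≤ β p)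
      bounds (suc x , y) (_ , (1≤y , y≤b)) =
        ℤ.+≤+ (≤-trans 1≤y (≤-trans (m≤n+m y x) (m≤m+n _ _))) ,
        ℤ.i<j⇒i≤pred[j] (ℤ.+<+ (≤-trans (s≤s (+-mono-≤ (+-monoʳ-≤ x y≤b) (m⊓n≤n t (suc x))))
                                         (≤-reflexive (rearrange x b))))
        where
          rearrange : ∀ x b → suc (x + b + suc x) ≡ b + 2 * suc x
          rearrange = solve-∀

  Rβ-next : ∀ {i j t} → InGrid a b (suc i , j) → t ≤ i → Rβ β (suc i , j) (+ suc (i + j + t))
  Rβ-next {i} {j} {t} gr t≤i =
    subst (λ n → Rβ β (suc i , j) (+ n)) (+-suc (i + j) t) (offset⇒Rβ gr (s≤s t≤i))

  -- γ i j t is the point of Γ over the grid point (i+1, j) with height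
  -- k = i + j + t, the t-th (from 0) element of R^β(i+1, j) = {i+j, …, 2i+j+1}.
  γ : ℕ → ℕ → ℕ → (ℕ × ℕ) × ℤ
  γ i j t = (suc i , j) , + (i + j + t)

  data Cell : (ℕ × ℕ) × ℤ → Set where
    cell : ∀ {i j t} → InGrid a b (suc i , j) → t ≤ i → Cell (γ i j t)

  InΓ⇒Cell : ∀ {x} → InΓ x → Cell x
  InΓ⇒Cell {(zero , _) , _} (((() , _) , _) , _)
  InΓ⇒Cell {(suc i , j) , _} (gr , Rk , (_ , Rk′ , k<k′)) with Rβ⇒offset gr Rk | Rβ⇒offset gr Rk′
  ... | t , _ , refl | t′ , t′≤1+i , refl =
    cell gr (s≤s⁻¹ (≤-trans (+-cancelˡ-< (i + j) t t′ (ℤ.drop‿+<+ k<k′)) t′≤1+i))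

  Cell⇒InΓ : ∀ {i j t} → InGrid a b (suc i , j) → t ≤ i → InΓ (γ i j t)
  Cell⇒InΓ {i} {j} {t} gr t≤i =
    gr , offset⇒Rβ gr (m≤n⇒m≤1+n t≤i) ,
    (_ , offset⇒Rβ gr (s≤s t≤i) , ℤ.+<+ (+-monoʳ-< (i + j) (n<1+n t)))

  down-cover : ∀ {i j t} → InGrid a b (suc i , j) → suc t ≤ i → ΓCov (γ i j (suc t)) (γ i j t)
  down-cover {i} {j} {t} gr 1+t≤i =
    subst (λ x → ΓCov x (γ i j t)) (sym γ≡)
      (ΓCov-same (subst InΓ γ≡ (Cell⇒InΓ gr 1+t≤i)) (Cell⇒InΓ gr (<⇒≤ 1+t≤i)))
    where
      γ≡ : γ i j (suc t) ≡ ((suc i , j) , + suc (i + j + t))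
      γ≡ = cong (λ n → (suc i , j) , + n) (+-suc (i + j) t)

  right-cover : ∀ {i j t} → InGrid a b (suc (suc i) , j) → t ≤ i → ΓCov (γ i j t) (γ (suc i) j t)
  right-cover {i} {j} gr′@((_ , 2+i≤a) , gy) t≤i =
    ΓCov-cross {suc i , j} (sum≡suc⇒Covers <G-right refl) (Cell⇒InΓ gr t≤i) (Rβ-next gr t≤i)
               (Cell⇒InΓ gr′ (m≤n⇒m≤1+n t≤i))
    where
      gr : InGrid a b (suc i , j)
      gr = (s≤s z≤n , <⇒≤ 2+i≤a) , gy

  up-cover : ∀ {i j t} → InGrid a b (suc i , j) → InGrid a b (suc i , suc j) → t ≤ i →
             ΓCov (γ i j t) (γ i (suc j) t)
  up-cover {i} {j} {t} gr gr′ t≤i =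
    subst (ΓCov (γ i j t)) (sym γ≡)
      (ΓCov-cross {suc i , j} (sum≡suc⇒Covers <G-up (+-suc (suc i) j))
                  (Cell⇒InΓ gr t≤i) (Rβ-next gr t≤i) (subst InΓ γ≡ (Cell⇒InΓ gr′ t≤i)))
    where
      γ≡ : γ i (suc j) t ≡ ((suc i , suc j) , + suc (i + j + t))
      γ≡ = cong (λ n → (suc i , suc j) , + (n + t)) (+-suc i j)

  descend : ∀ {i j t t′} → InGrid a b (suc i , j) → t ≤ i → t′ ≤′ t → Γ≤ (γ i j t) (γ i j t′)
  descend gr t≤i ≤′-refl = ε
  descend gr t≤i (≤′-step t′≤′s) = down-cover gr t≤i ◅ descend gr (≤-trans (n≤1+n _) t≤i) t′≤′s

  rightward : ∀ {i i′ j t} → InGrid a b (suc i , j) → InGrid a b (suc i′ , j) → t ≤ i →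
              i ≤′ i′ → Γ≤ (γ i j t) (γ i′ j t)
  rightward gr gr′ t≤i ≤′-refl = ε
  rightward gr gr′ t≤i (≤′-step i≤′m) =
    rightward gr (InGrid-between gr gr′ (s≤s (≤′⇒≤ i≤′m)) (n≤1+n _) ≤-refl ≤-refl) t≤i i≤′m
    ◅◅ right-cover gr′ (≤-trans t≤i (≤′⇒≤ i≤′m)) ◅ ε

  upward : ∀ {i j j′ t} → InGrid a b (suc i , j) → InGrid a b (suc i , j′) → t ≤ i →
           j ≤′ j′ → Γ≤ (γ i j t) (γ i j′ t)
  upward gr gr′ t≤i ≤′-refl = ε
  upward gr gr′ t≤i (≤′-step j≤′m) =
    upward gr mid t≤i j≤′m ◅◅ up-cover mid gr′ t≤i ◅ ε
    where mid = InGrid-between gr gr′ ≤-refl ≤-refl (≤′⇒≤ j≤′m) (n≤1+n _)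

  offset : (ℕ × ℕ) × ℤ → ℕ
  offset ((i , j) , k) = ∣ k ∣ ∸ (pred i + j)

  toTri : (ℕ × ℕ) × ℤ → (ℕ × ℕ) × ℕ
  toTri x@((i , j) , _) = (a ∸ offset x , i) , j

  offset-γ : ∀ {i j t} → offset (γ i j t) ≡ t
  offset-γ {i} {j} {t} = m+n∸m≡n (i + j) t

  toTri-γ : ∀ {i j t} → toTri (γ i j t) ≡ ((a ∸ t , suc i) , j)
  toTri-γ {i} {j} {t} = cong (λ s → (a ∸ s , suc i) , j) (offset-γ {i} {j} {t})

  ¬InTriB-column0 : ∀ {u c} → ¬ InTriB a b ((u , 0) , c)
  ¬InTriB-column0 {u} (_ , (a∸u+1≤0 , _) , _) with m+n≤o⇒n≤o (a ∸ u) a∸u+1≤0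
  ... | ()

  fromTri : (y : (ℕ × ℕ) × ℕ) → InTriB a b y → (ℕ × ℕ) × ℤ
  fromTri ((u , zero) , c) py = ⊥-elim (¬InTriB-column0 py)
  fromTri ((u , suc i) , c) _ = γ i c (a ∸ u)

  toTri-in : ∀ x → InΓ x → InTriB a b (toTri x)
  toTri-in x px with InΓ⇒Cell px
  ... | cell {i} {j} {t} ((_ , 1+i≤a) , gy) t≤i = subst (InTriB a b) (sym toTri-γ)
    ((m<n⇒0<n∸m t<a , m∸n≤m a t) ,
     (≤-trans (≤-reflexive (trans (cong (_+ 1) (m∸[m∸n]≡n (<⇒≤ t<a))) (+-comm t 1))) (s≤s t≤i) , 1+i≤a) ,
     gy)
    where
      t<a : t < a
      t<a = ≤-trans (s≤s t≤i) 1+i≤a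

  fromTri-in : ∀ y (py : InTriB a b y) → InΓ (fromTri y py)
  fromTri-in ((u , zero) , c) py = ⊥-elim (¬InTriB-column0 py)
  fromTri-in ((u , suc i) , c) (_ , (a∸u+1≤1+i , 1+i≤a) , gc) =
    Cell⇒InΓ ((s≤s z≤n , 1+i≤a) , gc) (s≤s⁻¹ (subst (_≤ suc i) (+-comm (a ∸ u) 1) a∸u+1≤1+i))

  fromTri-toTri : ∀ x (px : InΓ x) → fromTri (toTri x) (toTri-in x px) ≡ x
  fromTri-toTri x px with InΓ⇒Cell px
  ... | cell {i} {j} {t} ((_ , 1+i≤a) , _) t≤i =
    cong (γ i j) (trans (cong (λ s → a ∸ (a ∸ s)) (offset-γ {i} {j} {t}))
                        (m∸[m∸n]≡n (≤-trans (m≤n⇒m≤1+n t≤i) 1+i≤a)))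

  toTri-fromTri : ∀ y (py : InTriB a b y) → toTri (fromTri y py) ≡ y
  toTri-fromTri ((u , zero) , c) py = ⊥-elim (¬InTriB-column0 py)
  toTri-fromTri ((u , suc i) , c) ((_ , u≤a) , _) =
    trans toTri-γ (cong (λ s → (s , suc i) , c) (m∸[m∸n]≡n u≤a))

  ≤TB-refl : ∀ {y} → y ≤TB y
  ≤TB-refl = ≤-refl , ≤-refl , ≤-refl

  ≤TB-trans : ∀ {x y z} → x ≤TB y → y ≤TB z → x ≤TB z
  ≤TB-trans (p₁ , p₂ , p₃) (q₁ , q₂ , q₃) = ≤-trans p₁ q₁ , ≤-trans p₂ q₂ , ≤-trans p₃ q₃

  γ-≤TB : ∀ {i j t i′ j′ t′} → t′ ≤ t → i ≤ i′ → j ≤ j′ → toTri (γ i j t) ≤TB toTri (γ i′ j′ t′)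
  γ-≤TB t′≤t i≤i′ j≤j′ =
    subst₂ _≤TB_ (sym toTri-γ) (sym toTri-γ) (∸-monoʳ-≤ a t′≤t , s≤s i≤i′ , j≤j′)

  γ-≤TB⁻¹ : ∀ {i j t i′ j′ t′} → t′ ≤ a → toTri (γ i j t) ≤TB toTri (γ i′ j′ t′) →
            t′ ≤ t × i ≤ i′ × j ≤ j′
  γ-≤TB⁻¹ t′≤a le with subst₂ _≤TB_ toTri-γ toTri-γ le
  ... | a∸t≤a∸t′ , 1+i≤1+i′ , j≤j′ =
    ≮⇒≥ (λ t<t′ → <⇒≱ (∸-monoʳ-< t<t′ t′≤a) a∸t≤a∸t′) , s≤s⁻¹ 1+i≤1+i′ , j≤j′

  -- A cross cover raises the height by exactly one, because the height one above
  -- the lower point is itself in R^β; with i + j rising by one, the offset cannot grow.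
  ΓCov-mono : ∀ {x y} → ΓCov x y → toTri x ≤TB toTri y
  ΓCov-mono (px , py , step) with InΓ⇒Cell px | InΓ⇒Cell py | step
  ... | cell {i} {j} {t} _ _ | cell _ _ | inj₁ (refl , _ , k′<k , _) =
    γ-≤TB (<⇒≤ (+-cancelˡ-< (i + j) _ t (ℤ.drop‿+<+ k′<k))) ≤-refl ≤-refl
  ... | cell {i} {j} {t} gr t≤i | cell {i′} {j′} {t′} _ _ | inj₂ ((p<q , _) , below , _) =
    γ-≤TB t′≤t (s≤s⁻¹ (proj₁ p<q)) (proj₁ (proj₂ p<q))
    where
      k′≤k+1 : i′ + j′ + t′ ≤ suc (i + j) + t
      k′≤k+1 = ℤ.drop‿+≤+ (IsBelow-≤-suc (Rβ-next gr t≤i) below)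
      t′≤t : t′ ≤ t
      t′≤t = +-cancelˡ-≤ (i′ + j′) t′ t (≤-trans k′≤k+1 (+-monoˡ-≤ t (s≤s⁻¹ (<G⇒sum< p<q))))

  Γ≤⇒≤TB : ∀ {x y} → Γ≤ x y → toTri x ≤TB toTri y
  Γ≤⇒≤TB = fold (_≤TB_ on toTri) (λ c → ≤TB-trans (ΓCov-mono c)) ≤TB-refl

  ≤TB⇒Γ≤ : ∀ {x y} → InΓ x → InΓ y → toTri x ≤TB toTri y → Γ≤ x y
  ≤TB⇒Γ≤ px py le with InΓ⇒Cell px | InΓ⇒Cell py
  ... | cell gr t≤i | cell gr′@((_ , 1+i′≤a) , _) t′≤i′
      with γ-≤TB⁻¹ (≤-trans (m≤n⇒m≤1+n t′≤i′) 1+i′≤a) le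
  ...   | t′≤t , i≤i′ , j≤j′ =
    descend gr t≤i (≤⇒≤′ t′≤t)
    ◅◅ rightward gr corner (≤-trans t′≤t t≤i) (≤⇒≤′ i≤i′)
    ◅◅ upward corner gr′ t′≤i′ (≤⇒≤′ j≤j′)
    where corner = InGrid-between gr gr′ (s≤s i≤i′) ≤-refl ≤-refl j≤j′

  Γ≅△×[b] : OrderIso (InΓGrid a b) (Γ≤Grid a b) (InTriB a b) _≤TB_
  Γ≅△×[b] = record
    { to      = λ x _ → toTri x
    ; to-in   = toTri-in
    ; from    = fromTri
    ; from-in = fromTri-in
    ; from-to = fromTri-toTri
    ; to-from = toTri-fromTri
    ; order   = λ _ _ px py → mk⇔ Γ≤⇒≤TB (≤TB⇒Γ≤ px py)
    }

lemma4p7 : (a b : ℕ) → 1 ≤ a → 1 ≤ b →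
    OrderIso (InΓGrid a b) (Γ≤Grid a b) (InTriB a b) _≤TB_
lemma4p7 a b _ _ = Grid.Γ≅△×[b] a b
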